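{- Suppose that every finite source-free digraph $D$ contains a quasikernel $Q$ with $|Q|\le\frac{1}{2}|V(D)|$. Then every finite digraph $D$ contains a quasikernel $Q$ with $|N^+[Q]|\ge\frac{1}{2}|V(D)|$.
   Context: A digraph is source-free if every vertex has in-degree at least $1$. A set of vertices is independent if there are no arcs between two of its vertices. $\mathrm{dist}(S,v)$ is the minimum over $u\in S$ of the length of a shortest directed path from $u$ to $v$. A quasikernel is an independent set $Q$ with $\mathrm{dist}(Q,x)\le 2$ for every $x\in V(D)$. For $S\subseteq V(D)$, $N^+[S]=S\cup\{v:\exists u\in S,\ uv\in E(D)\}$. -}

module Defs where

open import Data.Nat using (ℕ; _*_; _≤_)
open import Data.Bool using (Bool; true; false; _∧_; _∨_)
open import Data.Fin using (Fin)
open import Data.Fin.Subset using (Subset; _∈_; ∣_∣)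
open import Data.Fin.Properties using (any?)
open import Data.Vec using (tabulate; lookup)
open import Data.Product using (Σ; ∃; ∃-syntax; _×_; _,_)
open import Data.Sum using (_⊎_)
open import Relation.Binary.PropositionalEquality using (_≡_)
open import Relation.Nullary using (¬_; does)

-- A finite digraph on vertex set Fin n: adjacency as a Bool-valued relation,
-- no loops (arcs uv require u ≠ v). Antiparallel arcs uv, vu are allowed.
record Digraph (n : ℕ) : Set where
  field
    arc     : Fin n → Fin n → Bool
    loopless : ∀ v → arc v v ≡ false
open Digraph public

Arc : ∀ {n} → Digraph n → Fin n → Fin n → Set
Arc D u v = arc D u v ≡ true

SourceFree : ∀ {n} → Digraph n → Set
SourceFree {n} D = ∀ v → ∃[ u ] Arc D u v

Independent : ∀ {n} → Digraph n → Subset n → Set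
Independent D S = ∀ u v → u ∈ S → v ∈ S → ¬ Arc D u v

DistLe2 : ∀ {n} → Digraph n → Subset n → Fin n → Set
DistLe2 D S x =
  x ∈ S
  ⊎ (∃[ u ] (u ∈ S × Arc D u x))
  ⊎ (∃[ u ] ∃[ w ] (u ∈ S × Arc D u w × Arc D w x))

Quasikernel : ∀ {n} → Digraph n → Subset n → Set
Quasikernel D Q = Independent D Q × (∀ x → DistLe2 D Q x)

N⁺[_]_ : ∀ {n} → Subset n → Digraph n → Subset n
N⁺[ S ] D = tabulate λ v → lookup S v ∨ does (any? λ u → (lookup S u ∧ arc D u v) ≟b true)
  where
    open import Data.Bool.Properties using () renaming (_≟_ to _≟b_)

-- Induct on a region W of vertices still to be absorbed, looking for an independent Q ⊆ W
-- absorbing W within distance 2 with at least half of W inside N⁺[Q].  A vertex s ∈ W with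
-- no in-neighbour in W must be in Q: take it and shrink W to W ∖ N⁺[s]; the removed vertices
-- all lie in N⁺[Q].  If W has no such source, blow D up to a source-free digraph: every x ∈ W
-- gets 2(n+1) pendant out-neighbours and every x ∉ W gets n+1 disjoint 2-cycles.  A
-- quasikernel Q′ of the blow-up restricts to a valid Q on W, must contain every pendant of
-- every x ∈ W outside N⁺[Q], and meets every 2-cycle; so |Q′| ≤ |V|/2 forces at most half
-- of W to lie outside N⁺[Q].
module Submission where

open import Data.Bool using (Bool; true; false; _∧_; _∨_; not)
open import Data.Bool.Properties using (not-¬; not-involutive; ∨-zeroʳ) renaming (_≟_ to _≟ᵇ_)
open import Data.Fin using (Fin; zero; suc; _↑ˡ_; _↑ʳ_; splitAt; combine; remQuot)
open import Data.Fin.Properties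
  using (any?; splitAt-↑ˡ; splitAt-↑ʳ; splitAt⁻¹-↑ˡ; splitAt⁻¹-↑ʳ; remQuot-combine; combine-remQuot)
  renaming (_≟_ to _≟ᶠ_)
open import Data.Fin.Subset using (Subset; _∈_; _⊆_; ∣_∣; ⁅_⁆; _∪_)
open import Data.Fin.Subset.Properties using (x∈⁅x⁆; x∈⁅y⁆⇒x≡y; x∈p∪q⁺; x∈p∪q⁻)
open import Data.Nat using (ℕ; zero; suc; _+_; _*_; _≤_; _<_; _≤?_; z≤n; s≤s; s≤s⁻¹)
open import Data.Nat.Properties
open import Algebra.Properties.CommutativeMonoid.Sum +-0-commutativeMonoid
  using (sum; sum-syntax; ∑-distrib-+; sum-cong-≗)
open import Data.Nat.Tactic.RingSolver using (solve-∀)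
open import Data.Product using (∃-syntax; _×_; _,_; proj₁; proj₂; uncurry)
open import Data.Sum using (_⊎_; inj₁; inj₂; [_,_]′)
import Data.Sum as Sum
open import Data.Vec using ([]; _∷_; lookup; tabulate)
open import Data.Vec.Properties using (lookup∘tabulate; []=⇒lookup; lookup⇒[]=)
open import Data.Empty using (⊥-elim)
open import Function using (_∘_)
open import Relation.Binary.PropositionalEquality
open import Relation.Nullary using (¬_; Dec; yes; no; does; contradiction; ¬?)
open import Relation.Nullary.Decidable using (dec-true; dec-false; decidable-stable; _×-dec_)

open import Defs

private
  variable
    n : ℕ
    a b c : Bool

⟦_⟧ : Bool → ℕ
⟦ true ⟧ = 1
⟦ false ⟧ = 0

count : (Fin n → Bool) → ℕ
count P = sum (λ x → ⟦ P x ⟧)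

sum-mono-≤ : {f g : Fin n → ℕ} → (∀ i → f i ≤ g i) → sum f ≤ sum g
sum-mono-≤ {zero} f≤g = z≤n
sum-mono-≤ {suc n} f≤g = +-mono-≤ (f≤g zero) (sum-mono-≤ (f≤g ∘ suc))

sum-mono-< : {f g : Fin n → ℕ} → (∀ i → f i ≤ g i) → ∀ i → f i < g i → sum f < sum g
sum-mono-< f≤g zero f<g = +-mono-<-≤ f<g (sum-mono-≤ (f≤g ∘ suc))
sum-mono-< f≤g (suc i) f<g = +-mono-≤-< (f≤g zero) (sum-mono-< (f≤g ∘ suc) i f<g)

sum-const : ∀ m k → ∑[ i < m ] k ≡ m * k
sum-const zero k = refl
sum-const (suc m) k = cong (k +_) (sum-const m k)

sum-↑ : ∀ m {k} (f : Fin (m + k) → ℕ) → sum f ≡ sum (λ i → f (i ↑ˡ k)) + sum (λ j → f (m ↑ʳ j))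
sum-↑ zero f = refl
sum-↑ (suc m) f = trans (cong (f zero +_) (sum-↑ m (f ∘ suc))) (sym (+-assoc (f zero) _ _))

sum-combine : ∀ m {k} (f : Fin (m * k) → ℕ) → sum f ≡ ∑[ i < m ] ∑[ j < k ] f (combine i j)
sum-combine zero f = refl
sum-combine (suc m) {k} f =
  trans (sum-↑ k f) (cong (sum (λ j → f (j ↑ˡ m * k)) +_) (sum-combine m (λ y → f (k ↑ʳ y))))

sum-copies-≤ : ∀ n m (f : Fin (n + m * (n + n)) → ℕ) →
               ∑[ i < m ] ∑[ x < n ] (f (n ↑ʳ combine i (x ↑ˡ n)) + f (n ↑ʳ combine i (n ↑ʳ x))) ≤ sum f
sum-copies-≤ n m f = begin
  ∑[ i < m ] ∑[ x < n ] (copyˡ i x + copyʳ i x)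
    ≡⟨ sum-cong-≗ {m} (λ i → ∑-distrib-+ (copyˡ i) (copyʳ i)) ⟩
  ∑[ i < m ] (∑[ x < n ] copyˡ i x + ∑[ x < n ] copyʳ i x)
    ≡⟨ sum-cong-≗ {m} (λ i → sum-↑ n {n} (λ y → f (n ↑ʳ combine i y))) ⟨
  ∑[ i < m ] ∑[ y < n + n ] f (n ↑ʳ combine i y)
    ≡⟨ sum-combine m {n + n} (λ z → f (n ↑ʳ z)) ⟨
  sum (λ z → f (n ↑ʳ z))
    ≤⟨ m≤n+m _ _ ⟩
  sum (λ x → f (x ↑ˡ m * (n + n))) + sum (λ z → f (n ↑ʳ z))
    ≡⟨ sum-↑ n f ⟨
  sum f
    ∎
  where
  open ≤-Reasoning
  copyˡ copyʳ : Fin m → Fin n → ℕ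
  copyˡ i x = f (n ↑ʳ combine i (x ↑ˡ n))
  copyʳ i x = f (n ↑ʳ combine i (n ↑ʳ x))

count-true : count {n} (λ _ → true) ≡ n
count-true {n} = trans (sum-const n 1) (*-identityʳ n)

∣p∣≡count : (p : Subset n) → ∣ p ∣ ≡ count (lookup p)
∣p∣≡count [] = refl
∣p∣≡count (true ∷ p) = cong suc (∣p∣≡count p)
∣p∣≡count (false ∷ p) = ∣p∣≡count p

∧-true⁻ : ∀ a → a ∧ b ≡ true → a ≡ true × b ≡ true
∧-true⁻ true b≡true = refl , b≡true

∧-true⁺ : a ≡ true → b ≡ true → a ∧ b ≡ true
∧-true⁺ refl b≡true = b≡true

⟦⟧-mono : (a ≡ true → b ≡ true) → ⟦ a ⟧ ≤ ⟦ b ⟧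
⟦⟧-mono {false} _ = z≤n
⟦⟧-mono {true} a⇒b rewrite a⇒b refl = ≤-refl

⟦⟧-split : ∀ a b → ⟦ a ⟧ ≡ ⟦ a ∧ b ⟧ + ⟦ a ∧ not b ⟧
⟦⟧-split false _ = refl
⟦⟧-split true true = refl
⟦⟧-split true false = refl

⟦⟧-disjoint : (a ≡ true → b ≡ false) → (a ≡ true → c ≡ true) → (b ≡ true → c ≡ true) →
              ⟦ a ⟧ + ⟦ b ⟧ ≤ ⟦ c ⟧
⟦⟧-disjoint {false} _ _ b⇒c = ⟦⟧-mono b⇒c
⟦⟧-disjoint {true} a⇒¬b a⇒c _ rewrite a⇒¬b refl | a⇒c refl = ≤-refl

module _ {P R : Fin n → Bool} where

  count-< : ∀ {s} → (∀ x → P x ≡ true → R x ≡ true) → P s ≡ false → R s ≡ true → count P < count R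
  count-< {s} P⊆R Ps Rs =
    sum-mono-< (λ x → ⟦⟧-mono (P⊆R x)) s (subst₂ (λ a b → ⟦ a ⟧ < ⟦ b ⟧) (sym Ps) (sym Rs) ≤-refl)

  count-disjoint : {S : Fin n → Bool} → (∀ x → P x ≡ true → R x ≡ false) →
                   (∀ x → P x ≡ true → S x ≡ true) → (∀ x → R x ≡ true → S x ≡ true) →
                   count P + count R ≤ count S
  count-disjoint disjoint P⊆S R⊆S =
    ≤-trans (≤-reflexive (sym (∑-distrib-+ (λ x → ⟦ P x ⟧) (λ x → ⟦ R x ⟧))))
            (sum-mono-≤ (λ x → ⟦⟧-disjoint (disjoint x) (P⊆S x) (R⊆S x)))

count-split : (P R : Fin n → Bool) → count P ≡ count (λ x → P x ∧ R x) + count (λ x → P x ∧ not (R x))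
count-split P R =
  trans (sum-cong-≗ (λ x → ⟦⟧-split (P x) (R x)))
        (∑-distrib-+ (λ x → ⟦ P x ∧ R x ⟧) (λ x → ⟦ P x ∧ not (R x) ⟧))

-- Opaque so that unification sees N⁺ᵇ D S x instead of a stuck lookup into a tabulation.
opaque
  N⁺ᵇ : Digraph n → Subset n → Fin n → Bool
  N⁺ᵇ D S = lookup (N⁺[ S ] D)

opaque
  unfolding N⁺ᵇ

  ∣N⁺[S]∣≡count : (D : Digraph n) (S : Subset n) → ∣ N⁺[ S ] D ∣ ≡ count (N⁺ᵇ D S)
  ∣N⁺[S]∣≡count D S = ∣p∣≡count (N⁺[ S ] D)

module _ {D : Digraph n} {S : Subset n} {x : Fin n} where

  private
    arc-from-S? : Dec (∃[ u ] ((lookup S u ∧ arc D u x) ≡ true))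
    arc-from-S? = any? (λ u → (lookup S u ∧ arc D u x) ≟ᵇ true)

    opaque
      unfolding N⁺ᵇ

      N⁺ᵇ-unfold : N⁺ᵇ D S x ≡ (lookup S x ∨ does arc-from-S?)
      N⁺ᵇ-unfold = lookup∘tabulate _ x

  ∈N⁺⁺ : x ∈ S ⊎ ∃[ u ] (u ∈ S × Arc D u x) → N⁺ᵇ D S x ≡ true
  ∈N⁺⁺ (inj₁ x∈S) = trans N⁺ᵇ-unfold (cong (_∨ does arc-from-S?) ([]=⇒lookup x∈S))
  ∈N⁺⁺ (inj₂ (u , u∈S , u→x)) =
    trans N⁺ᵇ-unfold (trans (cong (lookup S x ∨_) (dec-true arc-from-S? (u , ∧-true⁺ ([]=⇒lookup u∈S) u→x)))
                            (∨-zeroʳ _))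

  ∈N⁺⁻ : N⁺ᵇ D S x ≡ true → x ∈ S ⊎ ∃[ u ] (u ∈ S × Arc D u x)
  ∈N⁺⁻ x∈N⁺ with lookup S x in x∈S | arc-from-S? | trans (sym N⁺ᵇ-unfold) x∈N⁺
  ... | true  | _ | _ = inj₁ (lookup⇒[]= x S x∈S)
  ... | false | yes (u , p) | _ = inj₂ (u , lookup⇒[]= u S (proj₁ (∧-true⁻ _ p)) , proj₂ (∧-true⁻ _ p))

N⁺-mono : {D : Digraph n} {S T : Subset n} {x : Fin n} → S ⊆ T → N⁺ᵇ D S x ≡ true → N⁺ᵇ D T x ≡ true
N⁺-mono S⊆T = ∈N⁺⁺ ∘ [ inj₁ ∘ S⊆T , (λ (u , u∈S , u→x) → inj₂ (u , S⊆T u∈S , u→x)) ]′ ∘ ∈N⁺⁻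

N⁺⇒DistLe2 : {D : Digraph n} {S : Subset n} {x : Fin n} → N⁺ᵇ D S x ≡ true → DistLe2 D S x
N⁺⇒DistLe2 = [ inj₁ , inj₂ ∘ inj₁ ]′ ∘ ∈N⁺⁻

DistLe2-mono : {D : Digraph n} {S T : Subset n} {x : Fin n} → S ⊆ T → DistLe2 D S x → DistLe2 D T x
DistLe2-mono S⊆T (inj₁ x∈S) = inj₁ (S⊆T x∈S)
DistLe2-mono S⊆T (inj₂ (inj₁ (u , u∈S , u→x))) = inj₂ (inj₁ (u , S⊆T u∈S , u→x))
DistLe2-mono S⊆T (inj₂ (inj₂ (u , w , u∈S , u→w , w→x))) = inj₂ (inj₂ (u , w , S⊆T u∈S , u→w , w→x))

HasPredecessorIn : Digraph n → (Fin n → Bool) → Fin n → Set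
HasPredecessorIn D W v = ∃[ u ] (W u ≡ true × Arc D u v)

SourceFreeOn : Digraph n → (Fin n → Bool) → Set
SourceFreeOn D W = ∀ v → W v ≡ true → HasPredecessorIn D W v

hasPredecessorIn? : (D : Digraph n) (W : Fin n → Bool) (v : Fin n) → Dec (HasPredecessorIn D W v)
hasPredecessorIn? D W v = any? (λ u → (W u ≟ᵇ true) ×-dec (arc D u v ≟ᵇ true))

source-or-sourceFreeOn : (D : Digraph n) (W : Fin n → Bool) →
                         (∃[ s ] (W s ≡ true × ¬ HasPredecessorIn D W s)) ⊎ SourceFreeOn D W
source-or-sourceFreeOn D W with any? (λ s → (W s ≟ᵇ true) ×-dec ¬? (hasPredecessorIn? D W s))
... | yes source = inj₁ source
... | no ¬source =
      inj₂ (λ v v∈W → decidable-stable (hasPredecessorIn? D W v) (λ ¬pred → ¬source (v , v∈W , ¬pred)))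

record QuasikernelOn (D : Digraph n) (W : Fin n → Bool) : Set where
  field
    Q           : Subset n
    Q⊆W         : ∀ {x} → x ∈ Q → W x ≡ true
    independent : Independent D Q
    absorbs     : ∀ x → W x ≡ true → DistLe2 D Q x
    covers-half : count W ≤ 2 * count (λ x → W x ∧ N⁺ᵇ D Q x)

module Peel (D : Digraph n) (W : Fin n → Bool) (s : Fin n)
            (s∈W : W s ≡ true) (s-source : ¬ HasPredecessorIn D W s) where

  rest : Fin n → Bool
  rest x = W x ∧ not (N⁺ᵇ D ⁅ s ⁆ x)

  s∈N⁺s : N⁺ᵇ D ⁅ s ⁆ s ≡ true
  s∈N⁺s = ∈N⁺⁺ (inj₁ (x∈⁅x⁆ s))

  rest⁻ : ∀ {x} → rest x ≡ true → W x ≡ true × N⁺ᵇ D ⁅ s ⁆ x ≡ false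
  rest⁻ {x} p =
    let (x∈W , x∉N⁺s) = ∧-true⁻ (W x) p in x∈W , trans (sym (not-involutive _)) (cong not x∉N⁺s)

  rest-smaller : count rest < count W
  rest-smaller =
    count-< {P = rest} {R = W} (λ _ → proj₁ ∘ rest⁻) (cong₂ (λ a b → a ∧ not b) s∈W s∈N⁺s) s∈W

  extend : QuasikernelOn D rest → QuasikernelOn D W
  extend K = record
    { Q = Q ; Q⊆W = Q⊆W ; independent = independent ; absorbs = absorbs ; covers-half = covers-half }
    where
    module K = QuasikernelOn K

    Q : Subset n
    Q = ⁅ s ⁆ ∪ K.Q

    ⁅s⁆⊆Q : ⁅ s ⁆ ⊆ Q
    ⁅s⁆⊆Q = x∈p∪q⁺ ∘ inj₁

    K⊆Q : K.Q ⊆ Q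
    K⊆Q = x∈p∪q⁺ ∘ inj₂

    ∈Q⁻ : ∀ {x} → x ∈ Q → x ≡ s ⊎ x ∈ K.Q
    ∈Q⁻ = Sum.map₁ (x∈⁅y⁆⇒x≡y s) ∘ x∈p∪q⁻ ⁅ s ⁆ K.Q

    Q⊆W : ∀ {x} → x ∈ Q → W x ≡ true
    Q⊆W x∈Q with ∈Q⁻ x∈Q
    ... | inj₁ refl = s∈W
    ... | inj₂ x∈K = proj₁ (rest⁻ (K.Q⊆W x∈K))

    independent : Independent D Q
    independent u v u∈Q v∈Q u→v with ∈Q⁻ u∈Q | ∈Q⁻ v∈Q
    ... | inj₁ refl | inj₁ refl = not-¬ u→v (loopless D s)
    ... | inj₁ refl | inj₂ v∈K = not-¬ (∈N⁺⁺ (inj₂ (s , x∈⁅x⁆ s , u→v))) (proj₂ (rest⁻ (K.Q⊆W v∈K)))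
    ... | inj₂ u∈K  | inj₁ refl = s-source (u , proj₁ (rest⁻ (K.Q⊆W u∈K)) , u→v)
    ... | inj₂ u∈K  | inj₂ v∈K = K.independent u v u∈K v∈K u→v

    absorbs : ∀ x → W x ≡ true → DistLe2 D Q x
    absorbs x x∈W with N⁺ᵇ D ⁅ s ⁆ x in x∈N⁺s
    ... | true  = DistLe2-mono {D = D} {x = x} ⁅s⁆⊆Q (N⁺⇒DistLe2 x∈N⁺s)
    ... | false = DistLe2-mono {D = D} {x = x} K⊆Q (K.absorbs x (cong₂ (λ a b → a ∧ not b) x∈W x∈N⁺s))

    covers-half : count W ≤ 2 * count (λ x → W x ∧ N⁺ᵇ D Q x)
    covers-half = begin
      count W                         ≡⟨ count-split W (N⁺ᵇ D ⁅ s ⁆) ⟩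
      near + count rest               ≤⟨ +-monoʳ-≤ near K.covers-half ⟩
      near + 2 * far                  ≤⟨ +-monoˡ-≤ (2 * far) (m≤m+n near (near + 0)) ⟩
      2 * near + 2 * far              ≡⟨ *-distribˡ-+ 2 near far ⟨
      2 * (near + far)                ≤⟨ *-monoʳ-≤ 2 (count-disjoint disjoint near⊆ far⊆) ⟩
      2 * count (λ x → W x ∧ N⁺ᵇ D Q x) ∎
      where
      open ≤-Reasoning
      near far : ℕ
      near = count (λ x → W x ∧ N⁺ᵇ D ⁅ s ⁆ x)
      far = count (λ x → rest x ∧ N⁺ᵇ D K.Q x)
      disjoint : ∀ x → W x ∧ N⁺ᵇ D ⁅ s ⁆ x ≡ true → rest x ∧ N⁺ᵇ D K.Q x ≡ false
      disjoint x p =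
        let (x∈W , x∈N⁺s) = ∧-true⁻ (W x) p in cong₂ (λ a b → (a ∧ not b) ∧ N⁺ᵇ D K.Q x) x∈W x∈N⁺s
      near⊆ : ∀ x → W x ∧ N⁺ᵇ D ⁅ s ⁆ x ≡ true → W x ∧ N⁺ᵇ D Q x ≡ true
      near⊆ x p = let (x∈W , x∈N⁺s) = ∧-true⁻ (W x) p in ∧-true⁺ x∈W (N⁺-mono ⁅s⁆⊆Q x∈N⁺s)
      far⊆ : ∀ x → rest x ∧ N⁺ᵇ D K.Q x ≡ true → W x ∧ N⁺ᵇ D Q x ≡ true
      far⊆ x p =
        let (x∈rest , x∈N⁺K) = ∧-true⁻ (rest x) p in ∧-true⁺ (proj₁ (rest⁻ x∈rest)) (N⁺-mono K⊆Q x∈N⁺K)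

-- The blow-up of a source-free region

*-cancelˡ-≤-slack : ∀ {m k a b} → k < m → m * a ≤ k + m * b → a ≤ b
*-cancelˡ-≤-slack {m} {k} {a} {b} k<m ma≤k+mb with a ≤? b
... | yes a≤b = a≤b
... | no a≰b = contradiction (+-cancelʳ-≤ (m * b) m k m+mb≤k+mb) (<⇒≱ k<m)
  where
  open ≤-Reasoning
  m+mb≤k+mb : m + m * b ≤ k + m * b
  m+mb≤k+mb = begin
    m + m * b  ≡⟨ *-suc m b ⟨
    m * suc b  ≤⟨ *-monoʳ-≤ m (≰⇒> a≰b) ⟩
    m * a      ≤⟨ ma≤k+mb ⟩
    k + m * b  ∎

-- m ≥ n + 1 layers make the n original vertices too few to pay for an unreached vertex.
r≤c-from-blowup : ∀ {n m c r d} → n < m → n ≡ (c + r) + d →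
                  2 * (m * (d + (r + r))) ≤ n + m * (n + n) → r ≤ c
r≤c-from-blowup {n} {m} {c} {r} {d} n<m n≡c+r+d bound =
  *-cancelˡ-≤ 2 (*-cancelˡ-≤-slack n<m (+-cancelʳ-≤ (m * (2 * (d + r))) _ _ (begin
    m * (2 * r) + m * (2 * (d + r))          ≡⟨ lhs m r d ⟩
    2 * (m * (d + (r + r)))                  ≤⟨ bound ⟩
    n + m * (n + n)                          ≡⟨ cong (λ k → n + m * (k + k)) n≡c+r+d ⟩
    n + m * ((c + r + d) + (c + r + d))      ≡⟨ rhs n m c r d ⟩
    n + m * (2 * c) + m * (2 * (d + r))      ∎)))
  where
  open ≤-Reasoning
  lhs : ∀ m r d → m * (2 * r) + m * (2 * (d + r)) ≡ 2 * (m * (d + (r + r)))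
  lhs = solve-∀
  rhs : ∀ n m c r d → n + m * ((c + r + d) + (c + r + d)) ≡ n + m * (2 * c) + m * (2 * (d + r))
  rhs = solve-∀

does-true : ∀ {p} {P : Set p} (p? : Dec P) → does p? ≡ true → P
does-true (yes p) _ = p

module BlowUp (D : Digraph n) (W : Fin n → Bool) where

  data Vertex : Set where
    orig : Fin n → Vertex
    copy : Bool → Fin (suc n) → Fin n → Vertex

  infix 4 _↝_ _↝?_

  -- The arcs copy _ _ x → orig x for x ∉ W only keep orig x from being a source.
  _↝_ : Vertex → Vertex → Set
  orig u     ↝ orig v     = W u ≡ true × Arc D u v
  orig u     ↝ copy _ _ v = W u ≡ true × u ≡ v
  copy _ _ u ↝ orig v     = W u ≡ false × u ≡ v
  copy b i u ↝ copy c j v = W u ≡ false × c ≡ not b × i ≡ j × u ≡ v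

  _↝?_ : ∀ s t → Dec (s ↝ t)
  orig u     ↝? orig v     = (W u ≟ᵇ true) ×-dec (arc D u v ≟ᵇ true)
  orig u     ↝? copy _ _ v = (W u ≟ᵇ true) ×-dec (u ≟ᶠ v)
  copy _ _ u ↝? orig v     = (W u ≟ᵇ false) ×-dec (u ≟ᶠ v)
  copy b i u ↝? copy c j v = (W u ≟ᵇ false) ×-dec (c ≟ᵇ not b) ×-dec (i ≟ᶠ j) ×-dec (u ≟ᶠ v)

  ↝-irreflexive : ∀ s → ¬ s ↝ s
  ↝-irreflexive (orig u) (_ , u→u) = not-¬ u→u (loopless D u)
  ↝-irreflexive (copy false _ _) (_ , () , _)
  ↝-irreflexive (copy true _ _) (_ , () , _)

  size : ℕ
  size = n + suc n * (n + n)

  encode : Vertex → Fin size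
  encode (orig x)         = x ↑ˡ suc n * (n + n)
  encode (copy false i x) = n ↑ʳ combine i (x ↑ˡ n)
  encode (copy true i x)  = n ↑ʳ combine i (n ↑ʳ x)

  decodeCopy : Fin (suc n) × Fin (n + n) → Vertex
  decodeCopy (i , y) = [ copy false i , copy true i ]′ (splitAt n y)

  decode : Fin size → Vertex
  decode a = [ orig , decodeCopy ∘ remQuot (n + n) ]′ (splitAt n a)

  decode-copy : ∀ i y → decode (n ↑ʳ combine i y) ≡ decodeCopy (i , y)
  decode-copy i y = trans (cong [ orig , decodeCopy ∘ remQuot (n + n) ]′ (splitAt-↑ʳ n _ (combine i y)))
                          (cong decodeCopy (remQuot-combine i y))

  decode-encode : ∀ s → decode (encode s) ≡ s
  decode-encode (orig x) = cong [ orig , decodeCopy ∘ remQuot (n + n) ]′ (splitAt-↑ˡ n x _)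
  decode-encode (copy false i x) =
    trans (decode-copy i (x ↑ˡ n)) (cong [ copy false i , copy true i ]′ (splitAt-↑ˡ n x n))
  decode-encode (copy true i x) =
    trans (decode-copy i (n ↑ʳ x)) (cong [ copy false i , copy true i ]′ (splitAt-↑ʳ n n x))

  encode-decodeCopy : ∀ iy → encode (decodeCopy iy) ≡ n ↑ʳ uncurry combine iy
  encode-decodeCopy (i , y) with splitAt n y in split-y
  ... | inj₁ x = cong (λ y → n ↑ʳ combine i y) (splitAt⁻¹-↑ˡ split-y)
  ... | inj₂ x = cong (λ y → n ↑ʳ combine i y) (splitAt⁻¹-↑ʳ split-y)

  encode-decode : ∀ a → encode (decode a) ≡ a
  encode-decode a with splitAt n a in split-a
  ... | inj₁ x = splitAt⁻¹-↑ˡ split-a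
  ... | inj₂ b = begin
    encode (decodeCopy (remQuot (n + n) b))  ≡⟨ encode-decodeCopy (remQuot (n + n) b) ⟩
    n ↑ʳ uncurry combine (remQuot (n + n) b) ≡⟨ cong (n ↑ʳ_) (combine-remQuot (n + n) b) ⟩
    n ↑ʳ b                                   ≡⟨ splitAt⁻¹-↑ʳ split-a ⟩
    a                                        ∎
    where open ≡-Reasoning

  D′ : Digraph size
  D′ = record
    { arc      = λ a b → does (decode a ↝? decode b)
    ; loopless = λ a → dec-false (decode a ↝? decode a) (↝-irreflexive (decode a))
    }

  arc-encode : ∀ {s t} → s ↝ t → Arc D′ (encode s) (encode t)
  arc-encode {s} {t} s→t =
    subst₂ (λ s′ t′ → does (s′ ↝? t′) ≡ true) (sym (decode-encode s)) (sym (decode-encode t))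
           (dec-true (s ↝? t) s→t)

  arc-decode : ∀ {a b} → Arc D′ a b → decode a ↝ decode b
  arc-decode {a} {b} = does-true (decode a ↝? decode b)

  has-predecessor : SourceFreeOn D W → ∀ t → ∃[ s ] s ↝ t
  has-predecessor sf (orig v) with W v in v∈W
  ... | true  = let (u , u∈W , u→v) = sf v v∈W in orig u , u∈W , u→v
  ... | false = copy false zero v , v∈W , refl
  has-predecessor sf (copy b i v) with W v in v∈W
  ... | true  = orig v , v∈W , refl
  ... | false = copy (not b) i v , v∈W , sym (not-involutive b) , refl , refl

  sourceFree : SourceFreeOn D W → SourceFree D′
  sourceFree sf a =
    let (s , s→a) = has-predecessor sf (decode a) in
    encode s , subst (Arc D′ (encode s)) (encode-decode a) (arc-encode s→a)

  pred-orig : ∀ {s x} → W x ≡ true → s ↝ orig x → ∃[ u ] (s ≡ orig u × W u ≡ true × Arc D u x)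
  pred-orig {orig u} _ (u∈W , u→x) = u , refl , u∈W , u→x
  pred-orig {copy _ _ _} x∈W (x∉W , refl) = ⊥-elim (not-¬ x∈W x∉W)

  pred-copy-inside : ∀ {s b j x} → W x ≡ true → s ↝ copy b j x → s ≡ orig x
  pred-copy-inside {orig _} _ (_ , refl) = refl
  pred-copy-inside {copy _ _ _} x∈W (x∉W , _ , _ , refl) = ⊥-elim (not-¬ x∈W x∉W)

  pred-copy-outside : ∀ {s b j x} → W x ≡ false → s ↝ copy b j x → s ≡ copy (not b) j x
  pred-copy-outside {orig _} x∉W (x∈W , refl) = ⊥-elim (not-¬ x∈W x∉W)
  pred-copy-outside {copy c i u} _ (_ , refl , refl , refl) =
    cong (λ c → copy c i u) (sym (not-involutive c))

  module Restrict (Q′ : Subset size) (qk : Quasikernel D′ Q′) where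

    inQ′ : Vertex → Bool
    inQ′ s = lookup Q′ (encode s)

    Absorbed : Vertex → Set
    Absorbed t = inQ′ t ≡ true
               ⊎ ∃[ s ] (inQ′ s ≡ true × s ↝ t)
               ⊎ ∃[ s ] ∃[ s′ ] (inQ′ s ≡ true × s ↝ s′ × s′ ↝ t)

    private
      pull : ∀ {a} → a ∈ Q′ → inQ′ (decode a) ≡ true
      pull {a} a∈Q′ = []=⇒lookup (subst (_∈ Q′) (sym (encode-decode a)) a∈Q′)

      pull-arc : ∀ {a t} → Arc D′ a (encode t) → decode a ↝ t
      pull-arc {a} {t} a→t = subst (decode a ↝_) (decode-encode t) (arc-decode a→t)

    absorbed : ∀ t → Absorbed t
    absorbed t with proj₂ qk (encode t)
    ... | inj₁ t∈Q′ = inj₁ ([]=⇒lookup t∈Q′)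
    ... | inj₂ (inj₁ (a , a∈Q′ , a→t)) = inj₂ (inj₁ (decode a , pull a∈Q′ , pull-arc a→t))
    ... | inj₂ (inj₂ (a , a′ , a∈Q′ , a→a′ , a′→t)) =
          inj₂ (inj₂ (decode a , decode a′ , pull a∈Q′ , arc-decode a→a′ , pull-arc a′→t))

    Q : Subset n
    Q = tabulate (λ x → W x ∧ inQ′ (orig x))

    ∈Q⁺ : ∀ {x} → W x ≡ true → inQ′ (orig x) ≡ true → x ∈ Q
    ∈Q⁺ {x} x∈W o∈Q′ = lookup⇒[]= x Q (trans (lookup∘tabulate _ x) (∧-true⁺ x∈W o∈Q′))

    ∈Q⁻ : ∀ {x} → x ∈ Q → W x ≡ true × inQ′ (orig x) ≡ true
    ∈Q⁻ {x} x∈Q = ∧-true⁻ (W x) (trans (sym (lookup∘tabulate _ x)) ([]=⇒lookup x∈Q))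

    Q-independent : Independent D Q
    Q-independent u v u∈Q v∈Q u→v =
      proj₁ qk _ _ (lookup⇒[]= _ Q′ (proj₂ (∈Q⁻ u∈Q))) (lookup⇒[]= _ Q′ (proj₂ (∈Q⁻ v∈Q)))
        (arc-encode {orig u} {orig v} (proj₁ (∈Q⁻ u∈Q) , u→v))

    Q-absorbs : ∀ x → W x ≡ true → DistLe2 D Q x
    Q-absorbs x x∈W with absorbed (orig x)
    ... | inj₁ o∈Q′ = inj₁ (∈Q⁺ x∈W o∈Q′)
    ... | inj₂ (inj₁ (s , s∈Q′ , s→x)) with pred-orig x∈W s→x
    ...   | u , refl , u∈W , u→x = inj₂ (inj₁ (u , ∈Q⁺ u∈W s∈Q′ , u→x))
    Q-absorbs x x∈W | inj₂ (inj₂ (s , s′ , s∈Q′ , s→s′ , s′→x)) with pred-orig x∈W s′→x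
    ... | w , refl , w∈W , w→x with pred-orig w∈W s→s′
    ... | u , refl , u∈W , u→w = inj₂ (inj₂ (u , w , ∈Q⁺ u∈W s∈Q′ , u→w , w→x))

    unreached : Fin n → Bool
    unreached x = W x ∧ not (N⁺ᵇ D Q x)

    copy-forced : ∀ {x} b i → W x ≡ true → N⁺ᵇ D Q x ≡ false → inQ′ (copy b i x) ≡ true
    copy-forced {x} b i x∈W x∉N⁺ with absorbed (copy b i x)
    ... | inj₁ c∈Q′ = c∈Q′
    ... | inj₂ (inj₁ (s , s∈Q′ , s→c)) with pred-copy-inside x∈W s→c
    ...   | refl = ⊥-elim (not-¬ (∈N⁺⁺ (inj₁ (∈Q⁺ x∈W s∈Q′))) x∉N⁺)
    copy-forced b i x∈W x∉N⁺ | inj₂ (inj₂ (s , s′ , s∈Q′ , s→s′ , s′→c)) with pred-copy-inside x∈W s′→c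
    ... | refl with pred-orig x∈W s→s′
    ... | u , refl , u∈W , u→x = ⊥-elim (not-¬ (∈N⁺⁺ (inj₂ (u , ∈Q⁺ u∈W s∈Q′ , u→x))) x∉N⁺)

    twin-cover : ∀ {x} b i → W x ≡ false → inQ′ (copy b i x) ≡ true ⊎ inQ′ (copy (not b) i x) ≡ true
    twin-cover {x} b i x∉W with absorbed (copy b i x)
    ... | inj₁ c∈Q′ = inj₁ c∈Q′
    ... | inj₂ (inj₁ (s , s∈Q′ , s→c)) with pred-copy-outside x∉W s→c
    ...   | refl = inj₂ s∈Q′
    twin-cover b i x∉W | inj₂ (inj₂ (s , s′ , s∈Q′ , s→s′ , s′→c)) with pred-copy-outside x∉W s′→c
    ... | refl with pred-copy-outside x∉W s→s′
    ... | refl = inj₁ (subst (λ c → inQ′ (copy c i _) ≡ true) (not-involutive b) s∈Q′)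

    layer-bound : ∀ i x → ⟦ not (W x) ⟧ + (⟦ unreached x ⟧ + ⟦ unreached x ⟧)
                          ≤ ⟦ inQ′ (copy false i x) ⟧ + ⟦ inQ′ (copy true i x) ⟧
    layer-bound i x with W x in x∈W
    layer-bound i x | false with twin-cover false i x∈W
    ... | inj₁ c∈Q′ rewrite c∈Q′ = s≤s z≤n
    ... | inj₂ c∈Q′ rewrite c∈Q′ = m≤n+m 1 _
    layer-bound i x | true with N⁺ᵇ D Q x in x∈N⁺
    ... | true = z≤n
    ... | false rewrite copy-forced false i x∈W x∈N⁺ | copy-forced true i x∈W x∈N⁺ = ≤-refl

    Q′-lower : suc n * (count (not ∘ W) + (count unreached + count unreached)) ≤ ∣ Q′ ∣
    Q′-lower = begin
      suc n * (d + (r + r))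
        ≡⟨ sum-const (suc n) _ ⟨
      ∑[ i < suc n ] (d + (r + r))
        ≡⟨ sum-cong-≗ {suc n} (λ _ → layer-total) ⟨
      ∑[ i < suc n ] ∑[ x < n ] (⟦ not (W x) ⟧ + (⟦ unreached x ⟧ + ⟦ unreached x ⟧))
        ≤⟨ sum-mono-≤ {suc n} (λ i → sum-mono-≤ (layer-bound i)) ⟩
      ∑[ i < suc n ] ∑[ x < n ] (⟦ inQ′ (copy false i x) ⟧ + ⟦ inQ′ (copy true i x) ⟧)
        ≤⟨ sum-copies-≤ n (suc n) (λ a → ⟦ lookup Q′ a ⟧) ⟩
      count (lookup Q′)
        ≡⟨ ∣p∣≡count Q′ ⟨
      ∣ Q′ ∣
        ∎
      where
      open ≤-Reasoning
      d r : ℕ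
      d = count (not ∘ W)
      r = count unreached
      layer-total : ∑[ x < n ] (⟦ not (W x) ⟧ + (⟦ unreached x ⟧ + ⟦ unreached x ⟧)) ≡ d + (r + r)
      layer-total = trans (∑-distrib-+ (λ x → ⟦ not (W x) ⟧) (λ x → ⟦ unreached x ⟧ + ⟦ unreached x ⟧))
                          (cong (d +_) (∑-distrib-+ (λ x → ⟦ unreached x ⟧) (λ x → ⟦ unreached x ⟧)))

    quasikernelOn : 2 * ∣ Q′ ∣ ≤ size → QuasikernelOn D W
    quasikernelOn small = record
      { Q = Q ; Q⊆W = proj₁ ∘ ∈Q⁻ ; independent = Q-independent ; absorbs = Q-absorbs
      ; covers-half = covers-half
      }
      where
      open ≤-Reasoning
      reached : ℕ
      reached = count (λ x → W x ∧ N⁺ᵇ D Q x)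
      n≡reached+unreached+outside : n ≡ (reached + count unreached) + count (not ∘ W)
      n≡reached+unreached+outside = begin-equality
        n                                                   ≡⟨ count-true {n} ⟨
        count {n} (λ _ → true)                              ≡⟨ count-split (λ _ → true) W ⟩
        count W + count (not ∘ W)                           ≡⟨ cong (_+ count (not ∘ W)) (count-split W (N⁺ᵇ D Q)) ⟩
        (reached + count unreached) + count (not ∘ W)       ∎
      unreached≤reached : count unreached ≤ reached
      unreached≤reached =
        r≤c-from-blowup (n<1+n n) n≡reached+unreached+outside (≤-trans (*-monoʳ-≤ 2 Q′-lower) small)
      covers-half : count W ≤ 2 * reached
      covers-half = begin
        count W                    ≡⟨ count-split W (N⁺ᵇ D Q) ⟩
        reached + count unreached  ≤⟨ +-monoʳ-≤ reached unreached≤reached ⟩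
        reached + reached          ≡⟨ cong (reached +_) (+-identityʳ reached) ⟨
        2 * reached                ∎

SmallQuasikernels : Set
SmallQuasikernels = ∀ (n : ℕ) (D : Digraph n) → SourceFree D → ∃[ Q ] (Quasikernel D Q × 2 * ∣ Q ∣ ≤ n)

quasikernelOn-sourceFree : SmallQuasikernels → (D : Digraph n) (W : Fin n → Bool) →
                           SourceFreeOn D W → QuasikernelOn D W
quasikernelOn-sourceFree small D W sf =
  let (Q′ , qk , Q′-small) = small _ (BlowUp.D′ D W) (BlowUp.sourceFree D W sf) in
  BlowUp.Restrict.quasikernelOn D W Q′ qk Q′-small

quasikernelOn : SmallQuasikernels → (D : Digraph n) (W : Fin n → Bool) → QuasikernelOn D W
quasikernelOn small D W = go (suc (count W)) W ≤-refl
  where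
  go : ∀ k (W : Fin _ → Bool) → count W < k → QuasikernelOn D W
  go (suc k) W #W<1+k with source-or-sourceFreeOn D W
  ... | inj₂ sf = quasikernelOn-sourceFree small D W sf
  ... | inj₁ (s , s∈W , s-source) =
        Peel.extend D W s s∈W s-source (go k (Peel.rest D W s s∈W s-source)
          (≤-trans (Peel.rest-smaller D W s s∈W s-source) (s≤s⁻¹ #W<1+k)))

proposition2p9 : (∀ (n : ℕ) (D : Digraph n) → SourceFree D →
    ∃[ Q ] (Quasikernel D Q × 2 * ∣ Q ∣ ≤ n)) →
    ∀ (n : ℕ) (D : Digraph n) →
    ∃[ Q ] (Quasikernel D Q × n ≤ 2 * ∣ N⁺[ Q ] D ∣)
proposition2p9 small n D = Q , (independent , λ x → absorbs x refl) , n≤2∣N⁺[Q]∣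
  where
  open QuasikernelOn (quasikernelOn small D (λ _ → true))
  n≤2∣N⁺[Q]∣ : n ≤ 2 * ∣ N⁺[ Q ] D ∣
  n≤2∣N⁺[Q]∣ = subst₂ (λ k l → k ≤ 2 * l) count-true (sym (∣N⁺[S]∣≡count D Q)) covers-half
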